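{- Let $d_1,d_2,d_3$ be positive integers and $m_1,m_2,m_3\in\{0,1\}$ with $3\mid d_1+d_2+d_3+m_1+m_2+m_3+3$, and let $F=T(d_1,m_1,d_2,m_2,d_3,m_3)$, which has $N=d_1+d_2+d_3+m_1+m_2+m_3+4$ vertices. Let $\chi$ be a $\mathbb{Z}_3$-coloring of the edges of $K_N$ with $\alpha_{C_4}(\chi)\ge 1$ such that there is an alternating $4$-cycle $C$ for which the coloring restricted to $K_N-V(C)$ is not monochromatic. Then $K_N$ contains a copy of $F$ whose edge colors sum to $0$ in $\mathbb{Z}_3$.
   Context: $T(d_1,m_1,d_2,m_2,d_3,m_3)$ is the tree consisting of a vertex $u$ of degree $3$ and three vertices $p_1,p_2,p_3$, where for each $i$ the path joining $u$ to $p_i$ has $m_i$ internal vertices and $p_i$ additionally has $d_i$ leaf neighbors. For a $\mathbb{Z}_3$-coloring $\chi$ of a complete graph, a $4$-cycle is alternating if the sums of the colors on its two perfect matchings are distinct, and $\alpha_{C_4}(\chi)$ is the maximum number of pairwise vertex-disjoint alternating $4$-cycles. -}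

module Defs where

open import Data.Nat using (ℕ; zero; suc; _+_; _%_)
open import Data.Fin using (Fin; toℕ)
open import Data.Fin.Base using (zero; suc)
open import Data.List using (List; []; _∷_; _++_; map; concatMap; length)
open import Data.Nat.ListAction using (sum)
open import Data.List.Base using (allFin)
open import Data.List.Relation.Unary.AllPairs using (AllPairs)
open import Data.List.Relation.Unary.All using (All)
open import Data.Product using (_×_; _,_; Σ; ∃; ∃-syntax)
open import Data.Sum using (_⊎_)
open import Relation.Binary.PropositionalEquality using (_≡_; _≢_)
open import Relation.Nullary using (¬_)
open import Function.Definitions using (Injective)

-- ℤ₃ is represented by Fin 3; addition in ℤ₃ is addition of representatives mod 3.

-- An edge colouring of K_N with colours in ℤ₃: a symmetric function on
-- pairs of vertices (values on the diagonal are irrelevant: never used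
-- on non-edges below).
record Coloring (N : ℕ) : Set where
  field
    col  : Fin N → Fin N → Fin 3
    symm : ∀ x y → col x y ≡ col y x
open Coloring public

data TVert (d m : Fin 3 → ℕ) : Set where
  center : TVert d m                              -- u
  endv   : Fin 3 → TVert d m                      -- p_i
  inner  : (i : Fin 3) → Fin (m i) → TVert d m    -- internal vertices of the u–p_i path
  leaf   : (i : Fin 3) → Fin (d i) → TVert d m    -- leaf neighbours of p_i

consecutive : {A : Set} → List A → List (A × A)
consecutive []           = []
consecutive (x ∷ [])     = []
consecutive (x ∷ y ∷ xs) = (x , y) ∷ consecutive (y ∷ xs)

branchPath : (d m : Fin 3 → ℕ) → Fin 3 → List (TVert d m)
branchPath d m i = center ∷ (map (inner i) (allFin (m i)) ++ (endv i ∷ []))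

branchEdges : (d m : Fin 3 → ℕ) → Fin 3 → List (TVert d m × TVert d m)
branchEdges d m i = consecutive (branchPath d m i)
                    ++ map (λ j → (endv i , leaf i j)) (allFin (d i))

TEdges : (d m : Fin 3 → ℕ) → List (TVert d m × TVert d m)
TEdges d m = concatMap (branchEdges d m) (allFin 3)

vec3 : ℕ → ℕ → ℕ → Fin 3 → ℕ
vec3 a b c zero = a
vec3 a b c (suc zero) = b
vec3 a b c (suc (suc zero)) = c

T : ℕ → ℕ → ℕ → ℕ → ℕ → ℕ → Σ Set (λ V → List (V × V))
T d₁ m₁ d₂ m₂ d₃ m₃ = TVert (vec3 d₁ d₂ d₃) (vec3 m₁ m₂ m₃) , TEdges (vec3 d₁ d₂ d₃) (vec3 m₁ m₂ m₃)

edgeColorSum : ∀ {N} {V : Set} → Coloring N → (V → Fin N) → List (V × V) → ℕ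
edgeColorSum χ φ es = sum (map (λ e → toℕ (col χ (φ (Data.Product.proj₁ e)) (φ (Data.Product.proj₂ e)))) es)

HasZeroSumCopy : ∀ {N} → Coloring N → Σ Set (λ V → List (V × V)) → Set
HasZeroSumCopy {N} χ (V , E) =
  Σ (V → Fin N) λ φ → Injective _≡_ _≡_ φ × (edgeColorSum χ φ E % 3 ≡ 0)

-- A 4-cycle a–b–c–e–a in K_N on four distinct vertices.
record Cycle4 (N : ℕ) : Set where
  field
    a b c e : Fin N
    ab : a ≢ b
    ac : a ≢ c
    ae : a ≢ e
    bc : b ≢ c
    be : b ≢ e
    ce : c ≢ e
open Cycle4 public

_∈C_ : ∀ {N} → Fin N → Cycle4 N → Set
x ∈C C = x ≡ a C ⊎ x ≡ b C ⊎ x ≡ c C ⊎ x ≡ e C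

Alternating : ∀ {N} → Coloring N → Cycle4 N → Set
Alternating χ C =
  ((toℕ (col χ (a C) (b C)) + toℕ (col χ (c C) (e C))) % 3)
  ≢ ((toℕ (col χ (b C) (c C)) + toℕ (col χ (e C) (a C))) % 3)

Disjoint4 : ∀ {N} → Cycle4 N → Cycle4 N → Set
Disjoint4 C D = ∀ x → x ∈C C → ¬ (x ∈C D)

-- α_{C4}(χ) ≥ k : there are k pairwise vertex-disjoint alternating 4-cycles
-- (α_{C4} being the maximum such number).
αC4≥ : ∀ {N} → Coloring N → ℕ → Set
αC4≥ {N} χ k = ∃[ Cs ] (length Cs ≡ k × All (Alternating χ) Cs × AllPairs Disjoint4 Cs)

NotMonoOutside : ∀ {N} → Coloring N → Cycle4 N → Set
NotMonoOutside {N} χ C =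
  ∃[ x ] ∃[ y ] ∃[ z ] ∃[ w ]
    (x ≢ y × z ≢ w × ¬ (x ∈C C) × ¬ (y ∈C C) × ¬ (z ∈C C) × ¬ (w ∈C C)
     × col χ x y ≢ col χ z w)

{-# OPTIONS --safe #-}
module Submission where

-- Embed T so that the alternating cycle C = a b c e sits on p_i, a leaf at p_i, p_j and a leaf at p_j:
-- the copy uses the edges ab and ce, and exchanging the images b and e (σ) replaces them by bc and ea,
-- which changes the colour sum mod 3 because C is alternating.  Three vertices x, y, z outside C with
-- col(x,y) ≠ col(x,z) are embedded so that exchanging y and z (τ) also changes the sum mod 3; where
-- they go depends on the shape of T (an inner vertex, a branch with a single leaf, or else the centre
-- or a second leaf at p_i or p_j).  No edge of T joins a vertex moved by σ to one moved by τ, so the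
-- four embeddings have sums s, s + X, s + Y, s + X + Y with X, Y ≢ 0 (mod 3), and one of them is
-- divisible by 3.

open import Data.Fin using (Fin; zero; suc; toℕ; fromℕ<; _≟_)
open import Data.Fin.Patterns using (0F; 1F; 2F)
open import Data.Fin.Permutation.Components using (transpose; transpose-inverse)
open import Data.Fin.Properties using (toℕ-fromℕ<; toℕ-injective; toℕ<n; all?; any?; +↔⊎)
open import Data.List using (List; []; _∷_; _++_; map; allFin)
open import Data.List.Membership.Propositional using (_∈_)
open import Data.List.Membership.Propositional.Properties using (∈-map⁺; ∈-allFin)
open import Data.List.Properties using (map-++; map-cong-local; map-∘)
open import Data.List.Relation.Unary.All as All using (All; []; _∷_)
open import Data.List.Relation.Unary.All.Properties using (map⁺; ++⁺)
open import Data.List.Relation.Unary.AllPairs using ([]; _∷_)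
open import Data.List.Relation.Unary.Any using (here; there)
open import Data.List.Relation.Unary.Unique.Propositional using (Unique)
open import Data.List.Relation.Unary.Unique.Propositional.Properties using (allFin⁺)
open import Data.Nat using (ℕ; zero; suc; _+_; _≤_; _%_; s≤s)
import Data.Nat.Properties as ℕ
open import Data.Nat.Properties
  using (+-comm; +-assoc; +-identityʳ; +-cancelʳ-≡; +-commutativeSemigroup; ≤∧≢⇒<; n<1⇒n≡0)
open import Algebra.Properties.CommutativeSemigroup +-commutativeSemigroup using (interchange)
open import Data.Nat.Divisibility using (_∣_)
open import Data.Nat.DivMod using (_mod_; %-distribˡ-+; m%n<n; m<n⇒m%n≡m)
open import Data.Nat.ListAction using (sum)
open import Data.Nat.ListAction.Properties using (sum-++)
open import Data.Nat.Solver using (module +-*-Solver)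
open import Data.Product using (Σ-syntax; ∃-syntax; _×_; _,_; proj₁; proj₂)
open import Data.Sum using (_⊎_; inj₁; inj₂; [_,_]′)
import Data.Sum as Sum
open import Data.Sum.Function.Propositional using (_⊎-↣_)
open import Function using (_∘_; flip; _↣_; Injection)
open import Function.Construct.Composition using (_↣-∘_)
open import Function.Construct.Identity using (↣-id)
open import Function.Definitions using (Injective)
open import Function.Properties.Inverse using (↔⇒↣; ↔-sym)
open import Relation.Binary.PropositionalEquality
open import Relation.Nullary using (¬_; Dec; yes; no)
open import Relation.Nullary.Decidable using (dec-true; dec-false; toWitness; ¬?; _→-dec_; _⊎-dec_)

open import Defs

open +-*-Solver using (solve; _:=_; _:+_; con)

module _ {n : ℕ} where

  transpose-matchˡ : (i j : Fin n) → transpose i j i ≡ j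
  transpose-matchˡ i j rewrite dec-true (i ≟ i) refl = refl

  transpose-matchʳ : (i j : Fin n) → transpose i j j ≡ i
  transpose-matchʳ i j with i ≟ j
  ... | yes refl = transpose-matchˡ i i
  ... | no i≢j rewrite dec-false (j ≟ i) (i≢j ∘ sym) | dec-true (j ≟ j) refl = refl

  transpose-fixes : {i j k : Fin n} → k ≢ i → k ≢ j → transpose i j k ≡ k
  transpose-fixes {i} {j} {k} k≢i k≢j rewrite dec-false (k ≟ i) k≢i | dec-false (k ≟ j) k≢j = refl

  transpose-injective : (i j : Fin n) → Injective _≡_ _≡_ (transpose i j)
  transpose-injective i j {k} {l} eq = begin
    k                               ≡⟨ transpose-inverse j i ⟨
    transpose j i (transpose i j k) ≡⟨ cong (transpose j i) eq ⟩
    transpose j i (transpose i j l) ≡⟨ transpose-inverse j i ⟩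
    l                               ∎
    where open ≡-Reasoning

  transpose-avoids : {i j k t : Fin n} → k ≢ t → i ≢ t → j ≢ t → transpose i j k ≢ t
  transpose-avoids {i} {j} {k} {t} k≢t i≢t j≢t eq = k≢t (begin
    k                               ≡⟨ transpose-inverse j i ⟨
    transpose j i (transpose i j k) ≡⟨ cong (transpose j i) eq ⟩
    transpose j i t                 ≡⟨ transpose-fixes (j≢t ∘ sym) (i≢t ∘ sym) ⟩
    t                               ∎)
    where open ≡-Reasoning

transpose∘-fixes : {V : Set} {N : ℕ} {φ : V → Fin N} → Injective _≡_ _≡_ φ →
                   {P Q v : V} {p q : Fin N} → φ P ≡ p → φ Q ≡ q → v ≢ P → v ≢ Q →
                   φ v ≡ transpose p q (φ v)
transpose∘-fixes φ-inj φP≡p φQ≡q v≢P v≢Q =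
  sym (transpose-fixes (v≢P ∘ φ-inj ∘ flip trans (sym φP≡p)) (v≢Q ∘ φ-inj ∘ flip trans (sym φQ≡q)))

prescribe : {V : Set} {N : ℕ} (ι : V → Fin N) → Injective _≡_ _≡_ ι →
            (ps : List (V × Fin N)) → Unique (map proj₁ ps) → Unique (map proj₂ ps) →
            Σ[ φ ∈ (V → Fin N) ] Injective _≡_ _≡_ φ × All (λ p → φ (proj₁ p) ≡ proj₂ p) ps
prescribe ι ι-inj [] _ _ = ι , ι-inj , []
prescribe ι ι-inj ((v , t) ∷ ps) (v∉ ∷ vs!) (t∉ ∷ ts!) with prescribe ι ι-inj ps vs! ts!
... | φ , φ-inj , φ-ps =
  transpose (φ v) t ∘ φ , φ-inj ∘ transpose-injective (φ v) t , transpose-matchˡ (φ v) t ∷ All.tabulate kept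
  where
  kept : ∀ {p} → p ∈ ps → transpose (φ v) t (φ (proj₁ p)) ≡ proj₂ p
  kept {p} p∈ps = trans (transpose-fixes (All.lookup v∉ (∈-map⁺ proj₁ p∈ps) ∘ sym ∘ φ-inj)
                                         (All.lookup t∉ (∈-map⁺ proj₂ p∈ps) ∘ flip trans φp≡t ∘ sym))
                        φp≡t
    where
    φp≡t : φ (proj₁ p) ≡ proj₂ p
    φp≡t = All.lookup φ-ps p∈ps

module _ (d m : Fin 3 → ℕ) where

  TVertCode : Set
  TVertCode = (((((Fin (d 0F) ⊎ Fin (d 1F)) ⊎ Fin (d 2F)) ⊎ Fin (m 0F)) ⊎ Fin (m 1F)) ⊎ Fin (m 2F)) ⊎ Fin 4

  encode : TVert d m → TVertCode
  encode center       = inj₂ 0F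
  encode (endv l)     = inj₂ (suc l)
  encode (inner 2F r) = inj₁ (inj₂ r)
  encode (inner 1F r) = inj₁ (inj₁ (inj₂ r))
  encode (inner 0F r) = inj₁ (inj₁ (inj₁ (inj₂ r)))
  encode (leaf 2F r)  = inj₁ (inj₁ (inj₁ (inj₁ (inj₂ r))))
  encode (leaf 1F r)  = inj₁ (inj₁ (inj₁ (inj₁ (inj₁ (inj₂ r)))))
  encode (leaf 0F r)  = inj₁ (inj₁ (inj₁ (inj₁ (inj₁ (inj₁ r)))))

  decode : TVertCode → TVert d m
  decode (inj₂ 0F)                                   = center
  decode (inj₂ (suc l))                              = endv l
  decode (inj₁ (inj₂ r))                             = inner 2F r
  decode (inj₁ (inj₁ (inj₂ r)))                      = inner 1F r
  decode (inj₁ (inj₁ (inj₁ (inj₂ r))))               = inner 0F r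
  decode (inj₁ (inj₁ (inj₁ (inj₁ (inj₂ r)))))        = leaf 2F r
  decode (inj₁ (inj₁ (inj₁ (inj₁ (inj₁ (inj₂ r)))))) = leaf 1F r
  decode (inj₁ (inj₁ (inj₁ (inj₁ (inj₁ (inj₁ r)))))) = leaf 0F r

  decode-encode : ∀ v → decode (encode v) ≡ v
  decode-encode center       = refl
  decode-encode (endv l)     = refl
  decode-encode (inner 0F r) = refl
  decode-encode (inner 1F r) = refl
  decode-encode (inner 2F r) = refl
  decode-encode (leaf 0F r)  = refl
  decode-encode (leaf 1F r)  = refl
  decode-encode (leaf 2F r)  = refl

  TVertCode↣Fin : TVertCode ↣ Fin (d 0F + d 1F + d 2F + m 0F + m 1F + m 2F + 4)
  TVertCode↣Fin = extend (extend (extend (extend (extend +↣))))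
    where
    +↣ : ∀ {a b} → (Fin a ⊎ Fin b) ↣ Fin (a + b)
    +↣ = ↔⇒↣ (↔-sym +↔⊎)
    extend : ∀ {A : Set} {a b} → A ↣ Fin a → (A ⊎ Fin b) ↣ Fin (a + b)
    extend f = +↣ ↣-∘ (f ⊎-↣ ↣-id _)

  TVert↪Fin : Σ[ ι ∈ (TVert d m → Fin (d 0F + d 1F + d 2F + m 0F + m 1F + m 2F + 4)) ] Injective _≡_ _≡_ ι
  TVert↪Fin = to ∘ encode , λ {u} {v} eq →
    trans (sym (decode-encode u)) (trans (cong decode (injective eq)) (decode-encode v))
    where open Injection TVertCode↣Fin using (to; injective)

add-equations : ∀ a c a′ c′ {b d b′ d′} → a + b ≡ c + d → a′ + b′ ≡ c′ + d′ →
                (a + a′) + (b + b′) ≡ (c + c′) + (d + d′)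
add-equations a c a′ c′ {b} {d} {b′} {d′} e e′ =
  trans (interchange a a′ b b′) (trans (cong₂ _+_ e e′) (interchange c d c′ d′))

+-cross : ∀ {u v A B} → u ≡ A → v ≡ B → u + B ≡ v + A
+-cross {A = A} {B} u≡A v≡B = trans (cong (_+ B) u≡A) (trans (+-comm A B) (cong (_+ A) (sym v≡B)))

+-cancel-common : ∀ s s′ a b k → s + (a + k) ≡ s′ + (b + k) → s + a ≡ s′ + b
+-cancel-common s s′ a b k eq =
  +-cancelʳ-≡ k (s + a) (s′ + b) (trans (+-assoc s a k) (trans eq (sym (+-assoc s′ b k))))

sum-square : {A : Set} (g₀₀ g₁₀ g₀₁ g₁₁ : A → ℕ) (xs : List A) →
             All (λ x → (g₁₀ x ≡ g₀₀ x × g₁₁ x ≡ g₀₁ x) ⊎ (g₀₁ x ≡ g₀₀ x × g₁₁ x ≡ g₁₀ x)) xs →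
             sum (map g₁₁ xs) + sum (map g₀₀ xs) ≡ sum (map g₁₀ xs) + sum (map g₀₁ xs)
sum-square g₀₀ g₁₀ g₀₁ g₁₁ []       []         = refl
sum-square g₀₀ g₁₀ g₀₁ g₁₁ (x ∷ xs) (gx ∷ gxs) =
  add-equations (g₁₁ x) (g₁₀ x) (sum (map g₁₁ xs)) (sum (map g₁₀ xs))
                (square gx) (sum-square g₀₀ g₁₀ g₀₁ g₁₁ xs gxs)
  where
  square : (g₁₀ x ≡ g₀₀ x × g₁₁ x ≡ g₀₁ x) ⊎ (g₀₁ x ≡ g₀₀ x × g₁₁ x ≡ g₁₀ x) →
           g₁₁ x + g₀₀ x ≡ g₁₀ x + g₀₁ x
  square (inj₁ (e₁₀ , e₁₁)) = trans (cong₂ _+_ e₁₁ (sym e₁₀)) (+-comm (g₀₁ x) (g₁₀ x))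
  square (inj₂ (e₀₁ , e₁₁)) = cong₂ _+_ e₁₁ (sym e₀₁)

sum-update : {A : Set} (f g : A → ℕ) {xs : List A} {r : A} → Unique xs → r ∈ xs →
             (∀ x → x ≢ r → f x ≡ g x) → sum (map f xs) + g r ≡ sum (map g xs) + f r
sum-update f g {x ∷ xs} (x∉xs ∷ _) (here refl) agree = begin
  (f x + sum (map f xs)) + g x ≡⟨ cong (λ s → (f x + s) + g x) rest ⟩
  (f x + sum (map g xs)) + g x ≡⟨ +-comm (f x + sum (map g xs)) (g x) ⟩
  g x + (f x + sum (map g xs)) ≡⟨ cong (g x +_) (+-comm (f x) (sum (map g xs))) ⟩
  g x + (sum (map g xs) + f x) ≡⟨ +-assoc (g x) (sum (map g xs)) (f x) ⟨
  (g x + sum (map g xs)) + f x ∎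
  where
  open ≡-Reasoning
  rest : sum (map f xs) ≡ sum (map g xs)
  rest = cong sum (map-cong-local (All.map (λ {y} x≢y → agree y (x≢y ∘ sym)) x∉xs))
sum-update f g {x ∷ xs} {r} (x∉xs ∷ xs!) (there r∈xs) agree = begin
  (f x + sum (map f xs)) + g r ≡⟨ +-assoc (f x) (sum (map f xs)) (g r) ⟩
  f x + (sum (map f xs) + g r) ≡⟨ cong₂ _+_ (agree x (All.lookup x∉xs r∈xs)) (sum-update f g xs! r∈xs agree) ⟩
  g x + (sum (map g xs) + f r) ≡⟨ +-assoc (g x) (sum (map g xs)) (f r) ⟨
  (g x + sum (map g xs)) + f r ∎
  where open ≡-Reasoning

consecutive⁺ : {A : Set} {P : A → Set} {xs : List A} → All P xs →
               All (λ e → P (proj₁ e) × P (proj₂ e)) (consecutive xs)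
consecutive⁺ []              = []
consecutive⁺ (_ ∷ [])        = []
consecutive⁺ (px ∷ py ∷ pxs) = (px , py) ∷ consecutive⁺ (py ∷ pxs)

allFin-empty : ∀ {n} → n ≡ 0 → allFin n ≡ []
allFin-empty refl = refl

allFin-single : ∀ {n} → n ≡ 1 → (r : Fin n) → allFin n ≡ r ∷ []
allFin-single refl zero = refl

two-elements : ∀ {n} → 2 ≤ n → Σ[ r ∈ Fin n ] Σ[ r′ ∈ Fin n ] r′ ≢ r
two-elements {suc (suc _)} _         = zero , suc zero , λ ()
two-elements {suc zero}    (s≤s ())

data Branches : Fin 3 → Fin 3 → Fin 3 → Set where
  b012 : Branches 0F 1F 2F
  b021 : Branches 0F 2F 1F
  b102 : Branches 1F 0F 2F
  b120 : Branches 1F 2F 0F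
  b201 : Branches 2F 0F 1F
  b210 : Branches 2F 1F 0F

branches-ending-at : (k : Fin 3) → Σ[ i ∈ Fin 3 ] Σ[ j ∈ Fin 3 ] Branches i j k
branches-ending-at 0F = 1F , 2F , b120
branches-ending-at 1F = 0F , 2F , b021
branches-ending-at 2F = 0F , 1F , b012

module _ {i j k : Fin 3} where

  Branches-rotate : Branches i j k → Branches k i j
  Branches-rotate b012 = b201
  Branches-rotate b021 = b102
  Branches-rotate b102 = b210
  Branches-rotate b120 = b012
  Branches-rotate b201 = b120
  Branches-rotate b210 = b021

  Branches-swap : Branches i j k → Branches j i k
  Branches-swap b012 = b102
  Branches-swap b021 = b201
  Branches-swap b102 = b012
  Branches-swap b120 = b210
  Branches-swap b201 = b021
  Branches-swap b210 = b120

  Branches-distinct : Branches i j k → i ≢ j × i ≢ k × j ≢ k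
  Branches-distinct b012 = (λ ()) , (λ ()) , (λ ())
  Branches-distinct b021 = (λ ()) , (λ ()) , (λ ())
  Branches-distinct b102 = (λ ()) , (λ ()) , (λ ())
  Branches-distinct b120 = (λ ()) , (λ ()) , (λ ())
  Branches-distinct b201 = (λ ()) , (λ ()) , (λ ())
  Branches-distinct b210 = (λ ()) , (λ ()) , (λ ())

  sum-over-branches : (B : Fin 3 → ℕ) → Branches i j k → B 0F + (B 1F + (B 2F + 0)) ≡ B i + B j + B k
  sum-over-branches B b012 = solve 3 (λ x y z → x :+ (y :+ (z :+ con 0)) := x :+ y :+ z) refl (B 0F) (B 1F) (B 2F)
  sum-over-branches B b021 = solve 3 (λ x y z → x :+ (y :+ (z :+ con 0)) := x :+ z :+ y) refl (B 0F) (B 1F) (B 2F)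
  sum-over-branches B b102 = solve 3 (λ x y z → x :+ (y :+ (z :+ con 0)) := y :+ x :+ z) refl (B 0F) (B 1F) (B 2F)
  sum-over-branches B b120 = solve 3 (λ x y z → x :+ (y :+ (z :+ con 0)) := y :+ z :+ x) refl (B 0F) (B 1F) (B 2F)
  sum-over-branches B b201 = solve 3 (λ x y z → x :+ (y :+ (z :+ con 0)) := z :+ x :+ y) refl (B 0F) (B 1F) (B 2F)
  sum-over-branches B b210 = solve 3 (λ x y z → x :+ (y :+ (z :+ con 0)) := z :+ y :+ x) refl (B 0F) (B 1F) (B 2F)

module _ {d m : Fin 3 → ℕ} {l l′ : Fin 3} where

  endv-injective : endv {d} {m} l ≡ endv l′ → l ≡ l′
  endv-injective refl = refl

  inner-branch : ∀ {r r′} → inner {d} {m} l r ≡ inner l′ r′ → l ≡ l′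
  inner-branch refl = refl

  leaf-branch : ∀ {r r′} → leaf {d} {m} l r ≡ leaf l′ r′ → l ≡ l′
  leaf-branch refl = refl

leaf-injective : ∀ {d m l} {r r′ : Fin (d l)} → leaf {d} {m} l r ≡ leaf l r′ → r ≡ r′
leaf-injective refl = refl

data Spine {d m : Fin 3 → ℕ} : TVert d m → Set where
  center : Spine center
  endv   : ∀ l → Spine (endv l)
  inner  : ∀ l r → Spine (inner l r)

spine≢leaf : ∀ {d m l r} {v : TVert d m} → Spine v → v ≢ leaf l r
spine≢leaf center      ()
spine≢leaf (endv _)    ()
spine≢leaf (inner _ _) ()

data TreeEdge {d m : Fin 3 → ℕ} : TVert d m × TVert d m → Set where
  spine   : ∀ {u v} → Spine u → Spine v → TreeEdge (u , v)
  pendant : ∀ l r → TreeEdge (endv l , leaf l r)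

TEdges-shape : (d m : Fin 3 → ℕ) → All TreeEdge (TEdges d m)
TEdges-shape d m = ++⁺ (branch 0F) (++⁺ (branch 1F) (++⁺ (branch 2F) []))
  where
  branch : ∀ l → All TreeEdge (branchEdges d m l)
  branch l = ++⁺ (All.map (λ (su , sv) → spine su sv)
                          (consecutive⁺ (center ∷ ++⁺ (map⁺ (All.universal (inner l) (allFin (m l))))
                                                      (endv l ∷ []))))
                 (map⁺ (All.universal (pendant l) (allFin (d l))))

module TreeSums {N : ℕ} (χ : Coloring N) {d m : Fin 3 → ℕ} where

  colℕ : Fin N → Fin N → ℕ
  colℕ u v = toℕ (col χ u v)

  colℕ-symm : ∀ u v → colℕ u v ≡ colℕ v u
  colℕ-symm u v = cong toℕ (symm χ u v)

  weight : (TVert d m → Fin N) → TVert d m × TVert d m → ℕ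
  weight φ e = colℕ (φ (proj₁ e)) (φ (proj₂ e))

  treeSum : (TVert d m → Fin N) → ℕ
  treeSum φ = edgeColorSum χ φ (TEdges d m)

  pathSum leafSum branchSum : (TVert d m → Fin N) → Fin 3 → ℕ
  pathSum φ l   = edgeColorSum χ φ (consecutive (branchPath d m l))
  leafSum φ l   = edgeColorSum χ φ (map (λ r → (endv l , leaf l r)) (allFin (d l)))
  branchSum φ l = pathSum φ l + leafSum φ l

  edgeColorSum-++ : ∀ φ xs ys → edgeColorSum χ φ (xs ++ ys) ≡ edgeColorSum χ φ xs + edgeColorSum χ φ ys
  edgeColorSum-++ φ xs ys = trans (cong sum (map-++ (weight φ) xs ys)) (sum-++ (map (weight φ) xs) _)

  edgeColorSum-cong : ∀ {φ ψ : TVert d m → Fin N} {es} →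
                      All (λ e → φ (proj₁ e) ≡ ψ (proj₁ e) × φ (proj₂ e) ≡ ψ (proj₂ e)) es →
                      edgeColorSum χ φ es ≡ edgeColorSum χ ψ es
  edgeColorSum-cong agree = cong sum (map-cong-local (All.map (λ (e₁ , e₂) → cong₂ colℕ e₁ e₂) agree))

  treeSum-branches : ∀ φ {i j k} → Branches i j k → treeSum φ ≡ branchSum φ i + branchSum φ j + branchSum φ k
  treeSum-branches φ br = trans split (sum-over-branches (branchSum φ) br)
    where
    branch : ∀ l → edgeColorSum χ φ (branchEdges d m l) ≡ branchSum φ l
    branch l = edgeColorSum-++ φ (consecutive (branchPath d m l)) _
    split : treeSum φ ≡ branchSum φ 0F + (branchSum φ 1F + (branchSum φ 2F + 0))
    split = trans (edgeColorSum-++ φ (branchEdges d m 0F) _) (cong₂ _+_ (branch 0F)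
            (trans (edgeColorSum-++ φ (branchEdges d m 1F) _) (cong₂ _+_ (branch 1F)
            (trans (edgeColorSum-++ φ (branchEdges d m 2F) []) (cong (_+ 0) (branch 2F))))))

  module Square (φ₀₀ φ₁₀ φ₀₁ φ₁₁ : TVert d m → Fin N) where

    Fixed₁ Fixed₂ : TVert d m → Set
    Fixed₁ v = φ₁₀ v ≡ φ₀₀ v × φ₁₁ v ≡ φ₀₁ v
    Fixed₂ v = φ₀₁ v ≡ φ₀₀ v × φ₁₁ v ≡ φ₁₀ v

    treeSum-square : All (λ e → (Fixed₁ (proj₁ e) × Fixed₁ (proj₂ e)) ⊎ (Fixed₂ (proj₁ e) × Fixed₂ (proj₂ e)))
                         (TEdges d m) →
                     treeSum φ₁₁ + treeSum φ₀₀ ≡ treeSum φ₁₀ + treeSum φ₀₁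
    treeSum-square fixed = sum-square (weight φ₀₀) (weight φ₁₀) (weight φ₀₁) (weight φ₁₁) (TEdges d m)
                                      (All.map edge fixed)
      where
      edge : ∀ {e} → (Fixed₁ (proj₁ e) × Fixed₁ (proj₂ e)) ⊎ (Fixed₂ (proj₁ e) × Fixed₂ (proj₂ e)) →
             (weight φ₁₀ e ≡ weight φ₀₀ e × weight φ₁₁ e ≡ weight φ₀₁ e)
             ⊎ (weight φ₀₁ e ≡ weight φ₀₀ e × weight φ₁₁ e ≡ weight φ₁₀ e)
      edge (inj₁ ((u₁ , u₂) , (v₁ , v₂))) = inj₁ (cong₂ colℕ u₁ v₁ , cong₂ colℕ u₂ v₂)
      edge (inj₂ ((u₁ , u₂) , (v₁ , v₂))) = inj₂ (cong₂ colℕ u₁ v₁ , cong₂ colℕ u₂ v₂)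

  pathSum-cong : ∀ φ ψ l → φ center ≡ ψ center → φ (endv l) ≡ ψ (endv l) →
                 (∀ r → φ (inner l r) ≡ ψ (inner l r)) → pathSum φ l ≡ pathSum ψ l
  pathSum-cong φ ψ l at-center at-endv at-inner = edgeColorSum-cong (consecutive⁺
    (at-center ∷ ++⁺ (map⁺ (All.universal at-inner (allFin (m l)))) (at-endv ∷ [])))

  leafSum-cong : ∀ φ ψ l → φ (endv l) ≡ ψ (endv l) → (∀ r → φ (leaf l r) ≡ ψ (leaf l r)) →
                 leafSum φ l ≡ leafSum ψ l
  leafSum-cong φ ψ l at-endv at-leaf =
    edgeColorSum-cong (map⁺ (All.universal (λ r → at-endv , at-leaf r) (allFin (d l))))

  branchSum-cong : ∀ φ ψ l → φ center ≡ ψ center → φ (endv l) ≡ ψ (endv l) →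
                   (∀ r → φ (inner l r) ≡ ψ (inner l r)) → (∀ r → φ (leaf l r) ≡ ψ (leaf l r)) →
                   branchSum φ l ≡ branchSum ψ l
  branchSum-cong φ ψ l at-center at-endv at-inner at-leaf =
    cong₂ _+_ (pathSum-cong φ ψ l at-center at-endv at-inner) (leafSum-cong φ ψ l at-endv at-leaf)

  leafSum-update : ∀ φ ψ l r₀ {u s t} → φ (endv l) ≡ u → ψ (endv l) ≡ u →
                   (∀ r → r ≢ r₀ → φ (leaf l r) ≡ ψ (leaf l r)) → φ (leaf l r₀) ≡ s → ψ (leaf l r₀) ≡ t →
                   leafSum φ l + colℕ u t ≡ leafSum ψ l + colℕ u s
  leafSum-update φ ψ l r₀ {u} {s} {t} φl≡u ψl≡u at-leaf φr₀≡s ψr₀≡t = begin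
    leafSum φ l + colℕ u t                  ≡⟨ cong₂ _+_ (pointwise φ) (sym (cong₂ colℕ ψl≡u ψr₀≡t)) ⟩
    sum (map (f φ) (allFin (d l))) + f ψ r₀ ≡⟨ sum-update (f φ) (f ψ) (allFin⁺ (d l)) (∈-allFin r₀)
                                                 (λ r r≢r₀ → cong₂ colℕ (trans φl≡u (sym ψl≡u)) (at-leaf r r≢r₀)) ⟩
    sum (map (f ψ) (allFin (d l))) + f φ r₀ ≡⟨ cong₂ _+_ (sym (pointwise ψ)) (cong₂ colℕ φl≡u φr₀≡s) ⟩
    leafSum ψ l + colℕ u s                  ∎
    where
    open ≡-Reasoning
    f : (TVert d m → Fin N) → Fin (d l) → ℕ
    f φ r = weight φ (endv l , leaf l r)
    pointwise : ∀ φ → leafSum φ l ≡ sum (map (f φ) (allFin (d l)))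
    pointwise φ = cong sum (sym (map-∘ (allFin (d l))))

  pathSum-inner : ∀ φ l {rs} → allFin (m l) ≡ rs →
                  pathSum φ l ≡ edgeColorSum χ φ (consecutive (center ∷ (map (inner l) rs ++ (endv l ∷ []))))
  pathSum-inner φ l = cong (λ rs → edgeColorSum χ φ (consecutive (center ∷ (map (inner l) rs ++ (endv l ∷ [])))))

  pathSum-direct : ∀ φ l → m l ≡ 0 → pathSum φ l ≡ weight φ (center , endv l)
  pathSum-direct φ l mₗ≡0 = trans (pathSum-inner φ l (allFin-empty mₗ≡0)) (+-identityʳ _)

  pathSum-via : ∀ φ l → m l ≡ 1 → (w : Fin (m l)) →
                pathSum φ l ≡ weight φ (center , inner l w) + weight φ (inner l w , endv l)
  pathSum-via φ l mₗ≡1 w = trans (pathSum-inner φ l (allFin-single mₗ≡1 w))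
                                 (cong (weight φ (center , inner l w) +_) (+-identityʳ _))

  leafSum-single : ∀ φ l → d l ≡ 1 → (r : Fin (d l)) → leafSum φ l ≡ weight φ (endv l , leaf l r)
  leafSum-single φ l dₗ≡1 r = trans
    (cong (λ rs → edgeColorSum χ φ (map (λ r → (endv l , leaf l r)) rs)) (allFin-single dₗ≡1 r))
    (+-identityʳ _)

  branch-balance : ∀ φ ψ l {x y u v} → pathSum φ l + x ≡ pathSum ψ l + y → leafSum φ l + u ≡ leafSum ψ l + v →
                   branchSum φ l + (x + u) ≡ branchSum ψ l + (y + v)
  branch-balance φ ψ l = add-equations (pathSum φ l) (pathSum ψ l) (leafSum φ l) (leafSum ψ l)

  path-balance : ∀ φ ψ l {x y} → pathSum φ l + x ≡ pathSum ψ l + y → leafSum φ l ≡ leafSum ψ l →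
                 branchSum φ l + x ≡ branchSum ψ l + y
  path-balance φ ψ l {x} {y} path leaves =
    trans (cong (branchSum φ l +_) (sym (+-identityʳ x)))
          (trans (branch-balance φ ψ l path (cong (_+ 0) leaves)) (cong (branchSum ψ l +_) (+-identityʳ y)))

  treeSum-balance : ∀ φ ψ {i j k} → Branches i j k → ∀ {x y x′ y′ x″ y″} →
                    branchSum φ i + x ≡ branchSum ψ i + y → branchSum φ j + x′ ≡ branchSum ψ j + y′ →
                    branchSum φ k + x″ ≡ branchSum ψ k + y″ →
                    treeSum φ + (x + x′ + x″) ≡ treeSum ψ + (y + y′ + y″)
  treeSum-balance φ ψ {i} {j} {k} br {x} {y} {x′} {y′} {x″} {y″} eᵢ eⱼ eₖ =
    trans (cong (_+ _) (treeSum-branches φ br)) (trans all-branches (cong (_+ _) (sym (treeSum-branches ψ br))))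
    where
    Bφ Bψ : Fin 3 → ℕ
    Bφ = branchSum φ
    Bψ = branchSum ψ
    all-branches : Bφ i + Bφ j + Bφ k + (x + x′ + x″) ≡ Bψ i + Bψ j + Bψ k + (y + y′ + y″)
    all-branches = add-equations (Bφ i + Bφ j) (Bψ i + Bψ j) (Bφ k) (Bψ k)
                                 (add-equations (Bφ i) (Bψ i) (Bφ j) (Bψ j) eᵢ eⱼ) eₖ

  treeSum-swapLeaves : ∀ φ {l l′ l″} → Branches l l′ l″ → Injective _≡_ _≡_ φ →
                       ∀ {r r′ p q} → φ (leaf l r) ≡ p → φ (leaf l′ r′) ≡ q →
                       treeSum φ + (colℕ (φ (endv l)) q + colℕ (φ (endv l′)) p)
                         ≡ treeSum (transpose p q ∘ φ) + (colℕ (φ (endv l)) p + colℕ (φ (endv l′)) q)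
  treeSum-swapLeaves φ {l} {l′} {l″} br φ-inj {r} {r′} {p} {q} φr≡p φr′≡q =
    trans (cong (treeSum φ +_) (sym (+-identityʳ _)))
          (trans (treeSum-balance φ ψ br atl atl′ (cong (_+ 0) atl″)) (cong (treeSum ψ +_) (+-identityʳ _)))
    where
    ψ : TVert d m → Fin N
    ψ = transpose p q ∘ φ
    l≢l′ : l ≢ l′
    l≢l′ = proj₁ (Branches-distinct br)
    l≢l″ : l ≢ l″
    l≢l″ = proj₁ (proj₂ (Branches-distinct br))
    l′≢l″ : l′ ≢ l″
    l′≢l″ = proj₂ (proj₂ (Branches-distinct br))
    fixed : ∀ {v} → v ≢ leaf l r → v ≢ leaf l′ r′ → φ v ≡ ψ v
    fixed = transpose∘-fixes φ-inj φr≡p φr′≡q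
    path : ∀ n → pathSum φ n + 0 ≡ pathSum ψ n + 0
    path n = cong (_+ 0) (pathSum-cong φ ψ n (fixed (λ ()) (λ ())) (fixed (λ ()) (λ ())) (λ _ → fixed (λ ()) (λ ())))
    atl : branchSum φ l + colℕ (φ (endv l)) q ≡ branchSum ψ l + colℕ (φ (endv l)) p
    atl = branch-balance φ ψ l (path l) (leafSum-update φ ψ l r refl (sym (fixed (λ ()) (λ ())))
            (λ _ s≢r → fixed (s≢r ∘ leaf-injective) (l≢l′ ∘ leaf-branch))
            φr≡p (trans (cong (transpose p q) φr≡p) (transpose-matchˡ p q)))
    atl′ : branchSum φ l′ + colℕ (φ (endv l′)) p ≡ branchSum ψ l′ + colℕ (φ (endv l′)) q
    atl′ = branch-balance φ ψ l′ (path l′) (leafSum-update φ ψ l′ r′ refl (sym (fixed (λ ()) (λ ())))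
             (λ _ s≢r′ → fixed (l≢l′ ∘ sym ∘ leaf-branch) (s≢r′ ∘ leaf-injective))
             φr′≡q (trans (cong (transpose p q) φr′≡q) (transpose-matchʳ p q)))
    atl″ : branchSum φ l″ ≡ branchSum ψ l″
    atl″ = branchSum-cong φ ψ l″ (fixed (λ ()) (λ ())) (fixed (λ ()) (λ ())) (λ _ → fixed (λ ()) (λ ()))
             (λ _ → fixed (l≢l″ ∘ sym ∘ leaf-branch) (l′≢l″ ∘ sym ∘ leaf-branch))

toℕ-mod3 : ∀ n → toℕ (n mod 3) ≡ n % 3
toℕ-mod3 n = toℕ-fromℕ< (m%n<n n 3)

toℕ-%3 : (c : Fin 3) → toℕ c % 3 ≡ toℕ c
toℕ-%3 c = m<n⇒m%n≡m (toℕ<n c)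

%3-+ : ∀ a b → (a + b) % 3 ≡ (toℕ (a mod 3) + toℕ (b mod 3)) % 3
%3-+ a b = trans (%-distribˡ-+ a b 3) (sym (cong₂ (λ u v → (u + v) % 3) (toℕ-mod3 a) (toℕ-mod3 b)))

%3⇒mod3 : ∀ a b → a % 3 ≡ b % 3 → a mod 3 ≡ b mod 3
%3⇒mod3 a b eq = toℕ-injective (trans (toℕ-mod3 a) (trans eq (sym (toℕ-mod3 b))))

mod3⇒%3 : ∀ a b → a mod 3 ≡ b mod 3 → a % 3 ≡ b % 3
mod3⇒%3 a b eq = trans (sym (toℕ-mod3 a)) (trans (cong toℕ eq) (toℕ-mod3 b))

-- Opaque: unfolding these decision procedures makes later type checking very slow.
opaque
  +-cancelˡ-Fin3 : ∀ (t u v : Fin 3) → (toℕ t + toℕ u) % 3 ≡ (toℕ t + toℕ v) % 3 → u ≡ v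
  +-cancelˡ-Fin3 = toWitness {a? = all? λ t → all? λ u → all? λ v →
    ((toℕ t + toℕ u) % 3 ℕ.≟ (toℕ t + toℕ v) % 3) →-dec (u ≟ v)} _

  square-Fin3 : ∀ (s₀₀ s₁₀ s₀₁ s₁₁ : Fin 3) → (toℕ s₁₁ + toℕ s₀₀) % 3 ≡ (toℕ s₁₀ + toℕ s₀₁) % 3 →
                s₁₀ ≢ s₀₀ → s₀₁ ≢ s₀₀ → s₀₀ ≡ 0F ⊎ s₁₀ ≡ 0F ⊎ s₀₁ ≡ 0F ⊎ s₁₁ ≡ 0F
  square-Fin3 = toWitness {a? = all? λ s₀₀ → all? λ s₁₀ → all? λ s₀₁ → all? λ s₁₁ →
    ((toℕ s₁₁ + toℕ s₀₀) % 3 ℕ.≟ (toℕ s₁₀ + toℕ s₀₁) % 3) →-dec ¬? (s₁₀ ≟ s₀₀) →-dec ¬? (s₀₁ ≟ s₀₀) →-dec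
    (s₀₀ ≟ 0F ⊎-dec s₁₀ ≟ 0F ⊎-dec s₀₁ ≟ 0F ⊎-dec s₁₁ ≟ 0F)} _

  -- If the last two fail, ay − az ≡ xy − xz ≡ cy − cz, so (ay + cy) − (az + cz) ≡ 2 (xy − xz) ≢ 0.
  three-switches-Fin3 : ∀ (ay az cy cz xy xz : Fin 3) → xy ≢ xz →
                        (toℕ ay + toℕ cy) % 3 ≢ (toℕ az + toℕ cz) % 3
                        ⊎ (toℕ xz + toℕ ay) % 3 ≢ (toℕ xy + toℕ az) % 3
                        ⊎ (toℕ xz + toℕ cy) % 3 ≢ (toℕ xy + toℕ cz) % 3
  three-switches-Fin3 = toWitness {a? = all? λ ay → all? λ az → all? λ cy → all? λ cz → all? λ xy → all? λ xz →
    ¬? (xy ≟ xz) →-dec (¬? ((toℕ ay + toℕ cy) % 3 ℕ.≟ (toℕ az + toℕ cz) % 3)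
                        ⊎-dec ¬? ((toℕ xz + toℕ ay) % 3 ℕ.≟ (toℕ xy + toℕ az) % 3)
                        ⊎-dec ¬? ((toℕ xz + toℕ cy) % 3 ℕ.≟ (toℕ xy + toℕ cz) % 3))} _

balance-%3 : ∀ s s′ {p q} → s + p ≡ s′ + q → p % 3 ≢ q % 3 → s % 3 ≢ s′ % 3
balance-%3 s s′ {p} {q} eq p≢q s≡s′ = p≢q (mod3⇒%3 p q (+-cancelˡ-Fin3 (s′ mod 3) (p mod 3) (q mod 3) (begin
  (toℕ (s′ mod 3) + toℕ (p mod 3)) % 3 ≡⟨ cong (λ t → (toℕ t + toℕ (p mod 3)) % 3) (%3⇒mod3 s s′ s≡s′) ⟨
  (toℕ (s mod 3) + toℕ (p mod 3)) % 3  ≡⟨ %3-+ s p ⟨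
  (s + p) % 3                          ≡⟨ cong (_% 3) eq ⟩
  (s′ + q) % 3                         ≡⟨ %3-+ s′ q ⟩
  (toℕ (s′ mod 3) + toℕ (q mod 3)) % 3 ∎)))
  where open ≡-Reasoning

square-%3 : ∀ s₀₀ s₁₀ s₀₁ s₁₁ → s₁₁ + s₀₀ ≡ s₁₀ + s₀₁ → s₁₀ % 3 ≢ s₀₀ % 3 → s₀₁ % 3 ≢ s₀₀ % 3 →
            s₀₀ % 3 ≡ 0 ⊎ s₁₀ % 3 ≡ 0 ⊎ s₀₁ % 3 ≡ 0 ⊎ s₁₁ % 3 ≡ 0
square-%3 s₀₀ s₁₀ s₀₁ s₁₁ eq s₁₀≢s₀₀ s₀₁≢s₀₀ =
  Sum.map (mod3⇒%3 s₀₀ 0) (Sum.map (mod3⇒%3 s₁₀ 0) (Sum.map (mod3⇒%3 s₀₁ 0) (mod3⇒%3 s₁₁ 0)))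
    (square-Fin3 (s₀₀ mod 3) (s₁₀ mod 3) (s₀₁ mod 3) (s₁₁ mod 3)
      (trans (sym (%3-+ s₁₁ s₀₀)) (trans (cong (_% 3) eq) (%3-+ s₁₀ s₀₁)))
      (s₁₀≢s₀₀ ∘ mod3⇒%3 s₁₀ s₀₀) (s₀₁≢s₀₀ ∘ mod3⇒%3 s₀₁ s₀₀))

record Cherry {N : ℕ} (χ : Coloring N) (C : Cycle4 N) : Set where
  field
    x y z       : Fin N
    x∉C         : ¬ x ∈C C
    y∉C         : ¬ y ∈C C
    z∉C         : ¬ z ∈C C
    x≢y         : x ≢ y
    x≢z         : x ≢ z
    bichromatic : col χ x y ≢ col χ x z

-- Along the walk y₁ x₁ z₁ w₁ the colour changes at x₁ or at z₁.
cherry : ∀ {N} {χ : Coloring N} {C : Cycle4 N} → NotMonoOutside χ C → Cherry χ C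
cherry {χ = χ} (x₁ , y₁ , z₁ , w₁ , x₁≢y₁ , z₁≢w₁ , x₁∉C , y₁∉C , z₁∉C , w₁∉C , x₁y₁≢z₁w₁) with x₁ ≟ z₁
... | yes refl = record { x = x₁ ; y = y₁ ; z = w₁ ; x∉C = x₁∉C ; y∉C = y₁∉C ; z∉C = w₁∉C
                        ; x≢y = x₁≢y₁ ; x≢z = z₁≢w₁ ; bichromatic = x₁y₁≢z₁w₁ }
... | no x₁≢z₁ with col χ x₁ y₁ ≟ col χ x₁ z₁
...   | no x₁y₁≢x₁z₁ = record { x = x₁ ; y = y₁ ; z = z₁ ; x∉C = x₁∉C ; y∉C = y₁∉C ; z∉C = z₁∉C
                              ; x≢y = x₁≢y₁ ; x≢z = x₁≢z₁ ; bichromatic = x₁y₁≢x₁z₁ }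
...   | yes x₁y₁≡x₁z₁ = record { x = z₁ ; y = x₁ ; z = w₁ ; x∉C = z₁∉C ; y∉C = x₁∉C ; z∉C = w₁∉C
                               ; x≢y = x₁≢z₁ ∘ sym ; x≢z = z₁≢w₁
                               ; bichromatic = x₁y₁≢z₁w₁ ∘ trans x₁y₁≡x₁z₁ ∘ trans (symm χ x₁ z₁) }

module Construction {N : ℕ} (χ : Coloring N) (C : Cycle4 N) (alt : Alternating χ C) (ch : Cherry χ C)
                    {d m : Fin 3 → ℕ} (ι : TVert d m → Fin N) (ι-inj : Injective _≡_ _≡_ ι)
                    {i j k : Fin 3} (br : Branches i j k) (rᵢ : Fin (d i)) (rⱼ : Fin (d j)) where

  open TreeSums χ {d} {m}
  open Cherry ch

  i≢j : i ≢ j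
  i≢j = proj₁ (Branches-distinct br)

  i≢k : i ≢ k
  i≢k = proj₁ (proj₂ (Branches-distinct br))

  j≢k : j ≢ k
  j≢k = proj₂ (proj₂ (Branches-distinct br))

  module _ {v : Fin N} (v∉C : ¬ v ∈C C) where

    a≢ : a C ≢ v
    a≢ = v∉C ∘ inj₁ ∘ sym

    b≢ : b C ≢ v
    b≢ = v∉C ∘ inj₂ ∘ inj₁ ∘ sym

    c≢ : c C ≢ v
    c≢ = v∉C ∘ inj₂ ∘ inj₂ ∘ inj₁ ∘ sym

    e≢ : e C ≢ v
    e≢ = v∉C ∘ inj₂ ∘ inj₂ ∘ inj₂ ∘ sym

  y≢z : y ≢ z
  y≢z y≡z = bichromatic (cong (col χ x) y≡z)

  bichromatic-%3 : colℕ x y % 3 ≢ colℕ x z % 3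
  bichromatic-%3 eq = bichromatic (toℕ-injective (trans (sym (toℕ-%3 (col χ x y))) (trans eq (toℕ-%3 (col χ x z)))))

  record Placement (X Y Z : TVert d m) : Set where
    field
      φ           : TVert d m → Fin N
      φ-injective : Injective _≡_ _≡_ φ
      at-a        : φ (endv i) ≡ a C
      at-b        : φ (leaf i rᵢ) ≡ b C
      at-c        : φ (endv j) ≡ c C
      at-e        : φ (leaf j rⱼ) ≡ e C
      at-x        : φ X ≡ x
      at-y        : φ Y ≡ y
      at-z        : φ Z ≡ z

  targets-unique : Unique (a C ∷ b C ∷ c C ∷ e C ∷ x ∷ y ∷ z ∷ [])
  targets-unique = (ab C ∷ ac C ∷ ae C ∷ a≢ x∉C ∷ a≢ y∉C ∷ a≢ z∉C ∷ [])
                 ∷ (bc C ∷ be C ∷ b≢ x∉C ∷ b≢ y∉C ∷ b≢ z∉C ∷ [])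
                 ∷ (ce C ∷ c≢ x∉C ∷ c≢ y∉C ∷ c≢ z∉C ∷ [])
                 ∷ (e≢ x∉C ∷ e≢ y∉C ∷ e≢ z∉C ∷ [])
                 ∷ (x≢y ∷ x≢z ∷ []) ∷ (y≢z ∷ []) ∷ [] ∷ []

  module _ {X Y Z : TVert d m} where

    private
      pairs : List (TVert d m × Fin N)
      pairs = (endv i , a C) ∷ (leaf i rᵢ , b C) ∷ (endv j , c C) ∷ (leaf j rⱼ , e C)
              ∷ (X , x) ∷ (Y , y) ∷ (Z , z) ∷ []

      toPlacement : Σ[ φ ∈ (TVert d m → Fin N) ] Injective _≡_ _≡_ φ × All (λ p → φ (proj₁ p) ≡ proj₂ p) pairs →
                    Placement X Y Z
      toPlacement (φ , φ-inj , φa ∷ φb ∷ φc ∷ φe ∷ φx ∷ φy ∷ φz ∷ []) = record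
        { φ = φ ; φ-injective = φ-inj ; at-a = φa ; at-b = φb ; at-c = φc ; at-e = φe
        ; at-x = φx ; at-y = φy ; at-z = φz }

    place : All (endv i ≢_) (X ∷ Y ∷ Z ∷ []) → All (leaf i rᵢ ≢_) (X ∷ Y ∷ Z ∷ []) →
            All (endv j ≢_) (X ∷ Y ∷ Z ∷ []) → All (leaf j rⱼ ≢_) (X ∷ Y ∷ Z ∷ []) →
            Unique (X ∷ Y ∷ Z ∷ []) → Placement X Y Z
    place pᵢ lᵢ pⱼ lⱼ XYZ! = toPlacement (prescribe ι ι-inj pairs
      (((λ ()) ∷ i≢j ∘ endv-injective ∷ (λ ()) ∷ pᵢ) ∷ ((λ ()) ∷ i≢j ∘ leaf-branch ∷ lᵢ)
       ∷ ((λ ()) ∷ pⱼ) ∷ lⱼ ∷ XYZ!)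
      targets-unique)

  module Switches {X Y Z : TVert d m} (P : Placement X Y Z) where
    open Placement P

    φ₁₀ φ₀₁ φ₁₁ : TVert d m → Fin N
    φ₁₀ = transpose (b C) (e C) ∘ φ
    φ₀₁ = transpose y z ∘ φ
    φ₁₁ = transpose (b C) (e C) ∘ φ₀₁

    open Square φ φ₁₀ φ₀₁ φ₁₁

    moved-x : φ₀₁ X ≡ x
    moved-x = trans (cong (transpose y z) at-x) (transpose-fixes x≢y x≢z)

    moved-y : φ₀₁ Y ≡ z
    moved-y = trans (cong (transpose y z) at-y) (transpose-matchˡ y z)

    moved-z : φ₀₁ Z ≡ y
    moved-z = trans (cong (transpose y z) at-z) (transpose-matchʳ y z)

    unmoved : ∀ {v} → v ≢ Y → v ≢ Z → φ v ≡ φ₀₁ v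
    unmoved = transpose∘-fixes φ-injective at-y at-z

    cycle-switch : treeSum φ₁₀ % 3 ≢ treeSum φ % 3
    cycle-switch =
      balance-%3 (treeSum φ) (treeSum φ₁₀) swapped (alt ∘ sym ∘ trans (cong (_% 3) (sym crossing))) ∘ sym
      where
      swapped : treeSum φ + (colℕ (a C) (e C) + colℕ (c C) (b C))
                  ≡ treeSum φ₁₀ + (colℕ (a C) (b C) + colℕ (c C) (e C))
      swapped = subst₂ (λ u v → treeSum φ + (colℕ u (e C) + colℕ v (b C))
                                  ≡ treeSum φ₁₀ + (colℕ u (b C) + colℕ v (e C)))
                       at-a at-c (treeSum-swapLeaves φ br φ-injective at-b at-e)
      crossing : colℕ (a C) (e C) + colℕ (c C) (b C) ≡ colℕ (b C) (c C) + colℕ (e C) (a C)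
      crossing = trans (+-comm (colℕ (a C) (e C)) (colℕ (c C) (b C)))
                       (cong₂ _+_ (colℕ-symm (c C) (b C)) (colℕ-symm (a C) (e C)))

    σ-fixed : ∀ {v} → φ v ≢ b C → φ v ≢ e C → Fixed₁ v
    σ-fixed v≢b v≢e = transpose-fixes v≢b v≢e
                    , transpose-fixes (transpose-avoids v≢b (b≢ y∉C ∘ sym) (b≢ z∉C ∘ sym))
                                      (transpose-avoids v≢e (e≢ y∉C ∘ sym) (e≢ z∉C ∘ sym))

    spine-σ-fixed : ∀ {v} → Spine v → Fixed₁ v
    spine-σ-fixed sv = σ-fixed (spine≢leaf sv ∘ φ-injective ∘ flip trans (sym at-b))
                               (spine≢leaf sv ∘ φ-injective ∘ flip trans (sym at-e))

    τ-fixed : ∀ {v t} → φ v ≡ t → t ≢ y → t ≢ z → Fixed₂ v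
    τ-fixed {v} φv≡t t≢y t≢z = fixes , cong (transpose (b C) (e C)) fixes
      where
      fixes : transpose y z (φ v) ≡ φ v
      fixes = transpose-fixes (t≢y ∘ trans (sym φv≡t)) (t≢z ∘ trans (sym φv≡t))

    same-parent : ∀ {l l′ r r′ t t′} → φ (leaf l r) ≡ t → φ (leaf l′ r′) ≡ t → φ (endv l′) ≡ t′ → φ (endv l) ≡ t′
    same-parent φr≡t φr′≡t φl′≡t′ =
      trans (cong (φ ∘ endv) (leaf-branch (φ-injective (trans φr≡t (sym φr′≡t))))) φl′≡t′

    separated : ∀ {ε} → TreeEdge ε → (Fixed₁ (proj₁ ε) × Fixed₁ (proj₂ ε)) ⊎ (Fixed₂ (proj₁ ε) × Fixed₂ (proj₂ ε))
    separated (spine su sv) = inj₁ (spine-σ-fixed su , spine-σ-fixed sv)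
    separated (pendant l r) = pendant-separated (φ (leaf l r) ≟ b C) (φ (leaf l r) ≟ e C)
      where
      pendant-separated : Dec (φ (leaf l r) ≡ b C) → Dec (φ (leaf l r) ≡ e C) →
                          (Fixed₁ (endv l) × Fixed₁ (leaf l r)) ⊎ (Fixed₂ (endv l) × Fixed₂ (leaf l r))
      pendant-separated (yes φr≡b) _          =
        inj₂ (τ-fixed (same-parent φr≡b at-b at-a) (a≢ y∉C) (a≢ z∉C) , τ-fixed φr≡b (b≢ y∉C) (b≢ z∉C))
      pendant-separated (no _)     (yes φr≡e) =
        inj₂ (τ-fixed (same-parent φr≡e at-e at-c) (c≢ y∉C) (c≢ z∉C) , τ-fixed φr≡e (e≢ y∉C) (e≢ z∉C))
      pendant-separated (no φr≢b)  (no φr≢e)  = inj₁ (spine-σ-fixed (endv l) , σ-fixed φr≢b φr≢e)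

    zeroSumCopy : treeSum φ₀₁ % 3 ≢ treeSum φ % 3 → HasZeroSumCopy χ (TVert d m , TEdges d m)
    zeroSumCopy τ-switch
      with square-%3 (treeSum φ) (treeSum φ₁₀) (treeSum φ₀₁) (treeSum φ₁₁)
                     (treeSum-square (All.map separated (TEdges-shape d m))) cycle-switch τ-switch
    ... | inj₁ s₀₀≡0               = φ , φ-injective , s₀₀≡0
    ... | inj₂ (inj₁ s₁₀≡0)        = φ₁₀ , φ-injective ∘ transpose-injective (b C) (e C) , s₁₀≡0
    ... | inj₂ (inj₂ (inj₁ s₀₁≡0)) = φ₀₁ , φ-injective ∘ transpose-injective y z , s₀₁≡0
    ... | inj₂ (inj₂ (inj₂ s₁₁≡0)) =
      φ₁₁ , φ-injective ∘ transpose-injective y z ∘ transpose-injective (b C) (e C) , s₁₁≡0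

  via-inner-vertex : m k ≡ 1 → Fin (m k) → Fin (d k) → HasZeroSumCopy χ (TVert d m , TEdges d m)
  via-inner-vertex mₖ≡1 w rₖ = zeroSumCopy (balance-%3 (treeSum φ) (treeSum φ₀₁) exact bichromatic-%3 ∘ sym)
    where
    P : Placement center (leaf k rₖ) (inner k w)
    P = place ((λ ()) ∷ (λ ()) ∷ (λ ()) ∷ []) ((λ ()) ∷ i≢k ∘ leaf-branch ∷ (λ ()) ∷ [])
              ((λ ()) ∷ (λ ()) ∷ (λ ()) ∷ []) ((λ ()) ∷ j≢k ∘ leaf-branch ∷ (λ ()) ∷ [])
              (((λ ()) ∷ (λ ()) ∷ []) ∷ ((λ ()) ∷ []) ∷ [] ∷ [])
    open Placement P
    open Switches P
    p : Fin N
    p = φ (endv k)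
    unchanged : ∀ {l} → l ≢ k → branchSum φ l + 0 ≡ branchSum φ₀₁ l + 0
    unchanged l≢k = cong (_+ 0) (branchSum-cong φ φ₀₁ _ (unmoved (λ ()) (λ ())) (unmoved (λ ()) (λ ()))
                      (λ _ → unmoved (λ ()) (l≢k ∘ inner-branch)) (λ _ → unmoved (l≢k ∘ leaf-branch) (λ ())))
    path : pathSum φ k ≡ colℕ x z + colℕ p z
    path = trans (pathSum-via φ k mₖ≡1 w)
                 (cong₂ _+_ (cong₂ colℕ at-x at-z) (trans (cong (flip colℕ p) at-z) (colℕ-symm z p)))
    path₀₁ : pathSum φ₀₁ k ≡ colℕ x y + colℕ p y
    path₀₁ = trans (pathSum-via φ₀₁ k mₖ≡1 w)
                   (cong₂ _+_ (cong₂ colℕ moved-x moved-z)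
                              (trans (cong₂ colℕ moved-z (sym (unmoved (λ ()) (λ ())))) (colℕ-symm y p)))
    at-k : branchSum φ k + ((colℕ x y + colℕ p y) + colℕ p z) ≡ branchSum φ₀₁ k + ((colℕ x z + colℕ p z) + colℕ p y)
    at-k = branch-balance φ φ₀₁ k (+-cross path path₀₁)
             (leafSum-update φ φ₀₁ k rₖ refl (sym (unmoved (λ ()) (λ ())))
               (λ _ s≢rₖ → unmoved (s≢rₖ ∘ leaf-injective) (λ ())) at-y moved-y)
    exact : treeSum φ + colℕ x y ≡ treeSum φ₀₁ + colℕ x z
    exact = +-cancel-common (treeSum φ) (treeSum φ₀₁) (colℕ x y) (colℕ x z) (colℕ p y + colℕ p z) (begin
      treeSum φ + (colℕ x y + (colℕ p y + colℕ p z))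
        ≡⟨ cong (treeSum φ +_) (+-assoc (colℕ x y) _ _) ⟨
      treeSum φ + ((colℕ x y + colℕ p y) + colℕ p z)
        ≡⟨ treeSum-balance φ φ₀₁ br (unchanged i≢k) (unchanged j≢k) at-k ⟩
      treeSum φ₀₁ + ((colℕ x z + colℕ p z) + colℕ p y)
        ≡⟨ cong (treeSum φ₀₁ +_) (+-assoc (colℕ x z) _ _) ⟩
      treeSum φ₀₁ + (colℕ x z + (colℕ p z + colℕ p y))
        ≡⟨ cong (λ t → treeSum φ₀₁ + (colℕ x z + t)) (+-comm (colℕ p z) _) ⟩
      treeSum φ₀₁ + (colℕ x z + (colℕ p y + colℕ p z)) ∎)
      where open ≡-Reasoning

  via-single-leaf : m k ≡ 0 → d k ≡ 1 → Fin (d k) → HasZeroSumCopy χ (TVert d m , TEdges d m)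
  via-single-leaf mₖ≡0 dₖ≡1 rₖ = zeroSumCopy (balance-%3 (treeSum φ₀₁) (treeSum φ) (sym exact) bichromatic-%3)
    where
    P : Placement center (endv k) (leaf k rₖ)
    P = place ((λ ()) ∷ i≢k ∘ endv-injective ∷ (λ ()) ∷ []) ((λ ()) ∷ (λ ()) ∷ i≢k ∘ leaf-branch ∷ [])
              ((λ ()) ∷ j≢k ∘ endv-injective ∷ (λ ()) ∷ []) ((λ ()) ∷ (λ ()) ∷ j≢k ∘ leaf-branch ∷ [])
              (((λ ()) ∷ (λ ()) ∷ []) ∷ ((λ ()) ∷ []) ∷ [] ∷ [])
    open Placement P
    open Switches P
    unchanged : ∀ {l} → l ≢ k → branchSum φ l + 0 ≡ branchSum φ₀₁ l + 0
    unchanged l≢k = cong (_+ 0) (branchSum-cong φ φ₀₁ _ (unmoved (λ ()) (λ ()))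
                      (unmoved (l≢k ∘ endv-injective) (λ ())) (λ _ → unmoved (λ ()) (λ ()))
                      (λ _ → unmoved (λ ()) (l≢k ∘ leaf-branch)))
    branch : ∀ ψ {s t} → ψ center ≡ x → ψ (endv k) ≡ s → ψ (leaf k rₖ) ≡ t → branchSum ψ k ≡ colℕ x s + colℕ s t
    branch ψ ψc≡x ψp≡s ψl≡t = cong₂ _+_ (trans (pathSum-direct ψ k mₖ≡0) (cong₂ colℕ ψc≡x ψp≡s))
                                        (trans (leafSum-single ψ k dₖ≡1 rₖ) (cong₂ colℕ ψp≡s ψl≡t))
    exact : treeSum φ + colℕ x z ≡ treeSum φ₀₁ + colℕ x y
    exact = +-cancel-common (treeSum φ) (treeSum φ₀₁) (colℕ x z) (colℕ x y) (colℕ y z) (begin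
      treeSum φ + (colℕ x z + colℕ y z)   ≡⟨ cong (λ t → treeSum φ + (colℕ x z + t)) (colℕ-symm y z) ⟩
      treeSum φ + (colℕ x z + colℕ z y)   ≡⟨ cong (treeSum φ +_) (branch φ₀₁ moved-x moved-y moved-z) ⟨
      treeSum φ + branchSum φ₀₁ k         ≡⟨ treeSum-balance φ φ₀₁ br (unchanged i≢k) (unchanged j≢k)
                                                (+-comm (branchSum φ k) (branchSum φ₀₁ k)) ⟩
      treeSum φ₀₁ + branchSum φ k         ≡⟨ cong (treeSum φ₀₁ +_) (branch φ at-x at-y at-z) ⟩
      treeSum φ₀₁ + (colℕ x y + colℕ y z) ∎)
      where open ≡-Reasoning

  module _ (rₖ : Fin (d k)) where

    z-at-center : m i ≡ 0 → m j ≡ 0 → m k ≡ 0 →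
                  (colℕ (a C) y + colℕ (c C) y) % 3 ≢ (colℕ (a C) z + colℕ (c C) z) % 3 →
                  HasZeroSumCopy χ (TVert d m , TEdges d m)
    z-at-center mᵢ≡0 mⱼ≡0 mₖ≡0 moves = zeroSumCopy (balance-%3 (treeSum φ) (treeSum φ₀₁) exact moves ∘ sym)
      where
      P : Placement (endv k) (leaf k rₖ) center
      P = place (i≢k ∘ endv-injective ∷ (λ ()) ∷ (λ ()) ∷ []) ((λ ()) ∷ i≢k ∘ leaf-branch ∷ (λ ()) ∷ [])
                (j≢k ∘ endv-injective ∷ (λ ()) ∷ (λ ()) ∷ []) ((λ ()) ∷ j≢k ∘ leaf-branch ∷ (λ ()) ∷ [])
                (((λ ()) ∷ (λ ()) ∷ []) ∷ ((λ ()) ∷ []) ∷ [] ∷ [])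
      open Placement P
      open Switches P
      side : ∀ {l t} → l ≢ k → m l ≡ 0 → φ (endv l) ≡ t → branchSum φ l + colℕ t y ≡ branchSum φ₀₁ l + colℕ t z
      side {l} {t} l≢k mₗ≡0 φl≡t = path-balance φ φ₀₁ l
        (+-cross (trans (pathSum-direct φ l mₗ≡0) (trans (cong₂ colℕ at-z φl≡t) (colℕ-symm z t)))
                 (trans (pathSum-direct φ₀₁ l mₗ≡0)
                        (trans (cong₂ colℕ moved-z (trans (sym (unmoved (λ ()) (λ ()))) φl≡t)) (colℕ-symm y t))))
        (leafSum-cong φ φ₀₁ l (unmoved (λ ()) (λ ())) (λ _ → unmoved (l≢k ∘ leaf-branch) (λ ())))
      at-k : branchSum φ k + (colℕ x y + colℕ x z) ≡ branchSum φ₀₁ k + (colℕ x z + colℕ x y)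
      at-k = branch-balance φ φ₀₁ k
        (+-cross (trans (pathSum-direct φ k mₖ≡0) (trans (cong₂ colℕ at-z at-x) (colℕ-symm z x)))
                 (trans (pathSum-direct φ₀₁ k mₖ≡0) (trans (cong₂ colℕ moved-z moved-x) (colℕ-symm y x))))
        (leafSum-update φ φ₀₁ k rₖ at-x moved-x (λ _ s≢rₖ → unmoved (s≢rₖ ∘ leaf-injective) (λ ())) at-y moved-y)
      exact : treeSum φ + (colℕ (a C) y + colℕ (c C) y) ≡ treeSum φ₀₁ + (colℕ (a C) z + colℕ (c C) z)
      exact = +-cancel-common (treeSum φ) (treeSum φ₀₁) _ _ (colℕ x y + colℕ x z) (begin
        treeSum φ + ((colℕ (a C) y + colℕ (c C) y) + (colℕ x y + colℕ x z))
          ≡⟨ treeSum-balance φ φ₀₁ br (side i≢k mᵢ≡0 at-a) (side j≢k mⱼ≡0 at-c) at-k ⟩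
        treeSum φ₀₁ + ((colℕ (a C) z + colℕ (c C) z) + (colℕ x z + colℕ x y))
          ≡⟨ cong (λ t → treeSum φ₀₁ + ((colℕ (a C) z + colℕ (c C) z) + t)) (+-comm (colℕ x z) (colℕ x y)) ⟩
        treeSum φ₀₁ + ((colℕ (a C) z + colℕ (c C) z) + (colℕ x y + colℕ x z)) ∎)
        where open ≡-Reasoning

    z-at-leafᵢ : (rᵢ′ : Fin (d i)) → rᵢ′ ≢ rᵢ →
                 (colℕ x z + colℕ (a C) y) % 3 ≢ (colℕ x y + colℕ (a C) z) % 3 →
                 HasZeroSumCopy χ (TVert d m , TEdges d m)
    z-at-leafᵢ rᵢ′ rᵢ′≢rᵢ moves = zeroSumCopy (balance-%3 (treeSum φ) (treeSum φ₀₁) exact moves ∘ sym)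
      where
      P : Placement (endv k) (leaf k rₖ) (leaf i rᵢ′)
      P = place (i≢k ∘ endv-injective ∷ (λ ()) ∷ (λ ()) ∷ [])
                ((λ ()) ∷ i≢k ∘ leaf-branch ∷ rᵢ′≢rᵢ ∘ sym ∘ leaf-injective ∷ [])
                (j≢k ∘ endv-injective ∷ (λ ()) ∷ (λ ()) ∷ [])
                ((λ ()) ∷ j≢k ∘ leaf-branch ∷ i≢j ∘ sym ∘ leaf-branch ∷ [])
                (((λ ()) ∷ (λ ()) ∷ []) ∷ (i≢k ∘ sym ∘ leaf-branch ∷ []) ∷ [] ∷ [])
      open Placement P
      open Switches P
      exact : treeSum φ + (colℕ x z + colℕ (a C) y) ≡ treeSum φ₀₁ + (colℕ x y + colℕ (a C) z)
      exact = subst₂ (λ u v → treeSum φ + (colℕ u z + colℕ v y) ≡ treeSum φ₀₁ + (colℕ u y + colℕ v z))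
                     at-x at-a (treeSum-swapLeaves φ (Branches-rotate br) φ-injective at-y at-z)

    z-at-leafⱼ : (rⱼ′ : Fin (d j)) → rⱼ′ ≢ rⱼ →
                 (colℕ x z + colℕ (c C) y) % 3 ≢ (colℕ x y + colℕ (c C) z) % 3 →
                 HasZeroSumCopy χ (TVert d m , TEdges d m)
    z-at-leafⱼ rⱼ′ rⱼ′≢rⱼ moves = zeroSumCopy (balance-%3 (treeSum φ) (treeSum φ₀₁) exact moves ∘ sym)
      where
      P : Placement (endv k) (leaf k rₖ) (leaf j rⱼ′)
      P = place (i≢k ∘ endv-injective ∷ (λ ()) ∷ (λ ()) ∷ [])
                ((λ ()) ∷ i≢k ∘ leaf-branch ∷ i≢j ∘ leaf-branch ∷ [])
                (j≢k ∘ endv-injective ∷ (λ ()) ∷ (λ ()) ∷ [])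
                ((λ ()) ∷ j≢k ∘ leaf-branch ∷ rⱼ′≢rⱼ ∘ sym ∘ leaf-injective ∷ [])
                (((λ ()) ∷ (λ ()) ∷ []) ∷ (j≢k ∘ sym ∘ leaf-branch ∷ []) ∷ [] ∷ [])
      open Placement P
      open Switches P
      exact : treeSum φ + (colℕ x z + colℕ (c C) y) ≡ treeSum φ₀₁ + (colℕ x y + colℕ (c C) z)
      exact = subst₂ (λ u v → treeSum φ + (colℕ u z + colℕ v y) ≡ treeSum φ₀₁ + (colℕ u y + colℕ v z))
                     at-x at-c (treeSum-swapLeaves φ (Branches-rotate (Branches-swap br)) φ-injective at-y at-z)

    via-short-branches : m i ≡ 0 → m j ≡ 0 → m k ≡ 0 →
                         (rᵢ′ : Fin (d i)) → rᵢ′ ≢ rᵢ → (rⱼ′ : Fin (d j)) → rⱼ′ ≢ rⱼ →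
                         HasZeroSumCopy χ (TVert d m , TEdges d m)
    via-short-branches mᵢ≡0 mⱼ≡0 mₖ≡0 rᵢ′ rᵢ′≢rᵢ rⱼ′ rⱼ′≢rⱼ =
      [ z-at-center mᵢ≡0 mⱼ≡0 mₖ≡0 , [ z-at-leafᵢ rᵢ′ rᵢ′≢rᵢ , z-at-leafⱼ rⱼ′ rⱼ′≢rⱼ ]′ ]′
        (three-switches-Fin3 (col χ (a C) y) (col χ (a C) z) (col χ (c C) y) (col χ (c C) z)
                             (col χ x y) (col χ x z) bichromatic)

module _ {N : ℕ} (χ : Coloring N) {d m : Fin 3 → ℕ} (1≤d : ∀ l → 1 ≤ d l) (m≤1 : ∀ l → m l ≤ 1)
         (ι : TVert d m → Fin N) (ι-inj : Injective _≡_ _≡_ ι)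
         (C : Cycle4 N) (alt : Alternating χ C) (notMono : NotMonoOutside χ C) where

  private
    module Build = Construction χ C alt (cherry notMono) ι ι-inj

    leafOf : ∀ l → Fin (d l)
    leafOf l = fromℕ< (1≤d l)

    short : ¬ (∃[ l ] m l ≡ 1) → ∀ l → m l ≡ 0
    short ∄m≡1 l = n<1⇒n≡0 (≤∧≢⇒< (m≤1 l) (∄m≡1 ∘ (l ,_)))

    bushy : ¬ (∃[ l ] d l ≡ 1) → ∀ l → 2 ≤ d l
    bushy ∄d≡1 l = ≤∧≢⇒< (1≤d l) (∄d≡1 ∘ (l ,_) ∘ sym)

  T-zeroSumCopy : HasZeroSumCopy χ (TVert d m , TEdges d m)
  T-zeroSumCopy with any? (λ l → m l ℕ.≟ 1) | any? (λ l → d l ℕ.≟ 1)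
  ... | yes (k , mₖ≡1) | _ with branches-ending-at k
  ...   | i , j , br = Build.via-inner-vertex br (leafOf i) (leafOf j)
                         mₖ≡1 (fromℕ< (ℕ.≤-reflexive (sym mₖ≡1))) (leafOf k)
  T-zeroSumCopy | no ∄m≡1 | yes (k , dₖ≡1) with branches-ending-at k
  ...   | i , j , br = Build.via-single-leaf br (leafOf i) (leafOf j) (short ∄m≡1 k) dₖ≡1 (leafOf k)
  T-zeroSumCopy | no ∄m≡1 | no ∄d≡1 with two-elements (bushy ∄d≡1 0F) | two-elements (bushy ∄d≡1 1F)
  ...   | rᵢ , rᵢ′ , rᵢ′≢rᵢ | rⱼ , rⱼ′ , rⱼ′≢rⱼ =
    Build.via-short-branches b012 rᵢ rⱼ (leafOf 2F) (short ∄m≡1 0F) (short ∄m≡1 1F) (short ∄m≡1 2F)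
                             rᵢ′ rᵢ′≢rᵢ rⱼ′ rⱼ′≢rⱼ

proposition4p21 : (d₁ d₂ d₃ m₁ m₂ m₃ : ℕ) →
    1 ≤ d₁ → 1 ≤ d₂ → 1 ≤ d₃ →
    m₁ ≤ 1 → m₂ ≤ 1 → m₃ ≤ 1 →
    3 ∣ (d₁ + d₂ + d₃ + m₁ + m₂ + m₃ + 3) →
    (χ : Coloring (d₁ + d₂ + d₃ + m₁ + m₂ + m₃ + 4)) →
    αC4≥ χ 1 →
    (∃[ C ] (Alternating χ C × NotMonoOutside χ C)) →
    HasZeroSumCopy χ (T d₁ m₁ d₂ m₂ d₃ m₃)
proposition4p21 d₁ d₂ d₃ m₁ m₂ m₃ 1≤d₁ 1≤d₂ 1≤d₃ m₁≤1 m₂≤1 m₃≤1 _ χ _ (C , alt , notMono) =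
  T-zeroSumCopy χ 1≤d m≤1 (proj₁ ι) (proj₂ ι) C alt notMono
  where
  ι : Σ[ ι ∈ (TVert (vec3 d₁ d₂ d₃) (vec3 m₁ m₂ m₃) → Fin (d₁ + d₂ + d₃ + m₁ + m₂ + m₃ + 4)) ] Injective _≡_ _≡_ ι
  ι = TVert↪Fin (vec3 d₁ d₂ d₃) (vec3 m₁ m₂ m₃)
  1≤d : ∀ l → 1 ≤ vec3 d₁ d₂ d₃ l
  1≤d 0F = 1≤d₁
  1≤d 1F = 1≤d₂
  1≤d 2F = 1≤d₃
  m≤1 : ∀ l → vec3 m₁ m₂ m₃ l ≤ 1
  m≤1 0F = m₁≤1
  m≤1 1F = m₂≤1
  m≤1 2F = m₃≤1
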